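{- Let $G$ be a finite simple undirected graph that is not complete. Let $S_G^{\dagger}$ be any vertex subset $S\subseteq V(G)$ with $i(G-S)\ge 2$ that minimizes $\frac{|S|}{i(G-S)}$ over all such subsets, and let $S_G^{\ddagger}$ be any vertex subset $S\subseteq V(G)$ with $i(G-S)\ge 2$ that minimizes $\frac{|S|}{i(G-S)-1}$ over all such subsets. If $|S_G^{\dagger}|\neq |S_G^{\ddagger}|$, then $|S_G^{\ddagger}|>|S_G^{\dagger}|$ and $i(G-S_G^{\ddagger})>i(G-S_G^{\dagger})$.
   Context: For a vertex subset $S\subseteq V(G)$, $i(G-S)$ denotes the number of isolated vertices (vertices of degree zero) in the graph $G-S$ obtained by deleting $S$. The isolated toughness is $I(G)=\min\{|S|/i(G-S): S\subseteq V(G),\ i(G-S)\ge 2\}$ and the isolated toughness variant is $I'(G)=\min\{|S|/(i(G-S)-1): S\subseteq V(G),\ i(G-S)\ge 2\}$; $S_G^{\dagger}$ and $S_G^{\ddagger}$ are subsets attaining these minima respectively. Since $G$ is not complete, subsets $S$ with $i(G-S)\ge 2$ exist. -}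

module Defs where

open import Data.Nat using (ℕ; _+_; _*_; _∸_; _≤_; _≥_)
open import Data.Bool using (Bool; true; false; not; _∧_; _≟_)
open import Data.Fin using (Fin)
open import Data.Fin.Subset using (Subset; ∣_∣)
open import Data.Vec using (lookup)
open import Data.List using (filter; length; allFin)
open import Data.Bool.ListAction using (any)
open import Data.Product using (_×_)
open import Relation.Binary.PropositionalEquality using (_≡_)
open import Relation.Nullary using (¬_)

record Graph (n : ℕ) : Set where
  field
    adj   : Fin n → Fin n → Bool
    sym   : ∀ u v → adj u v ≡ adj v u
    irrefl : ∀ v → adj v v ≡ false
open Graph public

IsComplete : ∀ {n} → Graph n → Set
IsComplete {n} G = ∀ (u v : Fin n) → ¬ (u ≡ v) → adj G u v ≡ true

kept : ∀ {n} → Subset n → Fin n → Bool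
kept S v = not (lookup S v)

isolatedB : ∀ {n} → Graph n → Subset n → Fin n → Bool
isolatedB {n} G S v = kept S v ∧ not (any (λ u → kept S u ∧ adj G v u) (allFin n))

iso : ∀ {n} → Graph n → Subset n → ℕ
iso {n} G S = length (filter (λ v → isolatedB G S v ≟ true) (allFin n))

-- S attains the isolated toughness minimum  min |S| / i(G-S)  over S with i(G-S) ≥ 2
-- (ratios compared by cross-multiplication; all denominators are ≥ 2 > 0).
IsDagger : ∀ {n} → Graph n → Subset n → Set
IsDagger {n} G S =
  iso G S ≥ 2 ×
  (∀ (T : Subset n) → iso G T ≥ 2 → ∣ S ∣ * iso G T ≤ ∣ T ∣ * iso G S)

-- S attains the variant minimum  min |S| / (i(G-S) - 1)  over S with i(G-S) ≥ 2
-- (denominators are ≥ 1 > 0).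
IsDdagger : ∀ {n} → Graph n → Subset n → Set
IsDdagger {n} G S =
  iso G S ≥ 2 ×
  (∀ (T : Subset n) → iso G T ≥ 2 →
     ∣ S ∣ * (iso G T ∸ 1) ≤ ∣ T ∣ * (iso G S ∸ 1))

{-# OPTIONS --safe #-}
module Submission where

-- Write a = |S†|, b = |S‡|, i = i(G - S†), j = i(G - S‡).  Minimality of S† against S‡ and of
-- S‡ against S† gives a/i ≤ b/j and b/(j-1) ≤ a/(i-1).  Adding the cross-multiplied forms,
-- a·j + b·(i-1) ≤ b·i + a·(j-1), i.e. a ≤ b, so a < b.  Then b·(i-1) ≤ a·(j-1) with a < b and
-- i - 1 ≥ 1 forces j - 1 > i - 1.

open import Defs using (Graph; IsComplete; IsDagger; IsDdagger; iso)
open import Data.Nat using (ℕ; suc; _*_; _+_; _∸_; _≤_; _<_; _>_; s≤s; z≤n; NonZero)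
open import Data.Nat.Properties
  using (*-suc; +-monoʳ-≤; +-cancelʳ-≤; *-monoʳ-≤; *-monoˡ-<; ≤∧≢⇒<; ≰⇒>; <⇒≱; <⇒≤; module ≤-Reasoning)
open import Data.Fin.Subset using (Subset; ∣_∣)
open import Data.Product using (_×_; _,_)
open import Relation.Binary.PropositionalEquality using (_≡_; _≢_; sym)
open import Relation.Nullary using (¬_)

m*[1+p]≤n*[1+o]∧n*o≤m*p⇒m≤n : ∀ {m n o p} →
  m * suc p ≤ n * suc o → n * o ≤ m * p → m ≤ n
m*[1+p]≤n*[1+o]∧n*o≤m*p⇒m≤n {m} {n} {o} {p} le₁ le₂ = +-cancelʳ-≤ (m * p) m n (begin
  m + m * p  ≡⟨ sym (*-suc m p) ⟩
  m * suc p  ≤⟨ le₁ ⟩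
  n * suc o  ≡⟨ *-suc n o ⟩
  n + n * o  ≤⟨ +-monoʳ-≤ n le₂ ⟩
  n + m * p  ∎)
  where open ≤-Reasoning

m<n∧n*o≤m*p⇒o<p : ∀ {m n p} o .{{_ : NonZero o}} → m < n → n * o ≤ m * p → o < p
m<n∧n*o≤m*p⇒o<p {m} {n} {p} o m<n le = ≰⇒> λ p≤o → <⇒≱ (begin-strict
  m * p  ≤⟨ *-monoʳ-≤ m p≤o ⟩
  m * o  <⟨ *-monoˡ-< o m<n ⟩
  n * o  ∎) le
  where open ≤-Reasoning

cross-ratios⇒<×< : ∀ {a b i j} → 2 ≤ i → 1 ≤ j →
  a * j ≤ b * i → b * (i ∸ 1) ≤ a * (j ∸ 1) → a ≢ b → a < b × i < j
cross-ratios⇒<×< {a} {b} {suc (suc i)} {suc j} (s≤s (s≤s z≤n)) (s≤s z≤n) le₁ le₂ a≢b =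
  a<b , s≤s (m<n∧n*o≤m*p⇒o<p (suc i) a<b le₂)
  where
  a<b : a < b
  a<b = ≤∧≢⇒< (m*[1+p]≤n*[1+o]∧n*o≤m*p⇒m≤n le₁ le₂) a≢b

proposition1 : ∀ {n : ℕ} (G : Graph n) → ¬ IsComplete G →
    (S₁ S₂ : Subset n) → IsDagger G S₁ → IsDdagger G S₂ →
    ¬ (∣ S₁ ∣ ≡ ∣ S₂ ∣) →
    (∣ S₂ ∣ > ∣ S₁ ∣) × (iso G S₂ > iso G S₁)
proposition1 G _ S₁ S₂ (iso₁≥2 , dagger) (iso₂≥2 , ddagger) |S₁|≢|S₂| =
  cross-ratios⇒<×< iso₁≥2 (<⇒≤ iso₂≥2)
    (dagger S₂ iso₂≥2) (ddagger S₁ iso₁≥2) |S₁|≢|S₂|
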